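{- $\operatorname{adim}(X_k)=2^{\Omega(k)}$ for all $k\in\mathbb{Z}^+$.
   Context: $\widehat{X_0}$ is the path $a,b,c$; $\widehat X$ is the graph with vertex set $\{a,b,c\}$ and single edge $ab$. The Cartesian product $G\,\square\,H$ has vertex set $V(G)\times V(H)$, with $(u_1,u_2)\sim(v_1,v_2)$ iff ($u_1=v_1$ and $u_2v_2\in E(H)$) or ($u_2=v_2$ and $u_1v_1\in E(G)$). For $i\ge1$, $\widehat{X_i}=\widehat{X_0}\,\square\,\widehat X\,\square\cdots\square\,\widehat X$ ($i$ copies of $\widehat X$), so vertices are $(i+1)$-tuples over $\{a,b,c\}$. $X_i$ is obtained from $\widehat{X_i}$ by adding, for each $1\le j\le i+1$, a new vertex $s_j$ adjacent to every vertex whose $j$th coordinate is $a$. $d(u,v)$ is graph distance and $d_1(u,v)=\min\{d(u,v),2\}$. A set $A\subseteq V(G)$ is an adjacency resolving set if for any distinct $x,y$ there is $z\in A$ with $d_1(x,z)\ne d_1(y,z)$; $\operatorname{adim}(G)$ is the minimum size of such a set. -}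

module Defs where

open import Data.Nat using (ℕ; zero; suc)
open import Data.Bool using (Bool; true; false; _∧_; _∨_; if_then_else_)
open import Data.Fin using (Fin)
import Data.Fin as Fin
open import Data.Vec using (Vec; []; _∷_; lookup)
open import Data.Sum using (_⊎_; inj₁; inj₂)
open import Data.Product using (Σ; _×_)
open import Data.List using (List)
open import Data.List.Membership.Propositional using (_∈_)
open import Relation.Binary.PropositionalEquality using (_≡_; _≢_)
open import Relation.Nullary.Decidable using (⌊_⌋)

data L : Set where
  a b c : L

_==L_ : L → L → Bool
a ==L a = true
b ==L b = true
c ==L c = true
_ ==L _ = false

pathAdj : L → L → Bool
pathAdj a b = true
pathAdj b a = true
pathAdj b c = true
pathAdj c b = true
pathAdj _ _ = false

xAdj : L → L → Bool
xAdj a b = true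
xAdj b a = true
xAdj _ _ = false

eqVec : ∀ {n} → Vec L n → Vec L n → Bool
eqVec [] [] = true
eqVec (x ∷ xs) (y ∷ ys) = (x ==L y) ∧ eqVec xs ys

prodAdj : ∀ {n} → Vec L n → Vec L n → Bool
prodAdj [] [] = false
prodAdj (x ∷ xs) (y ∷ ys) = (xAdj x y ∧ eqVec xs ys) ∨ ((x ==L y) ∧ prodAdj xs ys)

-- Adjacency in \hat{X_i} = \hat{X_0} □ \hat X □ ... □ \hat X (i copies of \hat X);
-- the first coordinate is the \hat{X_0} coordinate.
hatAdj : ∀ {i} → Vec L (suc i) → Vec L (suc i) → Bool
hatAdj (x ∷ xs) (y ∷ ys) = (pathAdj x y ∧ eqVec xs ys) ∨ ((x ==L y) ∧ prodAdj xs ys)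

-- Vertices of X_i: the (i+1)-tuples, plus s_j for j ∈ {1,..,i+1}
-- (s_j is represented by inj₂ of the index j-1 : Fin (i+1)).
V : ℕ → Set
V i = Vec L (suc i) ⊎ Fin (suc i)

adj : ∀ {i} → V i → V i → Bool
adj (inj₁ u) (inj₁ v) = hatAdj u v
adj (inj₁ u) (inj₂ j) = lookup u j ==L a
adj (inj₂ j) (inj₁ u) = lookup u j ==L a
adj (inj₂ _) (inj₂ _) = false

eqV : ∀ {i} → V i → V i → Bool
eqV (inj₁ u) (inj₁ v) = eqVec u v
eqV (inj₂ j) (inj₂ l) = ⌊ j Fin.≟ l ⌋
eqV _ _ = false

-- d_1(u,v) = min{d(u,v), 2}: 0 if u = v, 1 if adjacent, 2 otherwise.
d₁ : ∀ {i} → V i → V i → ℕ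
d₁ u v = if eqV u v then 0 else (if adj u v then 1 else 2)

AdjResolving : ∀ i → List (V i) → Set
AdjResolving i A = (x y : V i) → x ≢ y → Σ (V i) λ z → z ∈ A × (d₁ x z ≢ d₁ y z)

module Submission where

-- For w ∈ {a,b,c}^k the vertices (b,w) and (c,w) of X_k are twins
-- "up to distance one": every s_j sees them alike (their first coordinates b, c are
-- both different from a and the others agree), and a product vertex (z₀,z') is at d₁-distance 2 from both
-- unless z' lies in the closed neighbourhood of w in the product graph X̂^k.  Hence
-- a resolving vertex for the pair is a vertex (z₀,z') with w ∈ N[z'].  Every closed
-- neighbourhood N[z'] of X̂^k has at most k+1 elements (z' itself and the k vectors
-- obtained by swapping a ↔ b in one coordinate), so the 3^k vectors w are covered
-- by |A|·(k+1) pairs (resolving vertex, position), giving 3^k ≤ |A|·(k+1).  Since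
-- 2^k·(k+1) ≤ 3^k for k ≥ 4, this yields 2^k ≤ |A|, i.e. the statement with d = 1.

open import Defs
open import Data.Nat using (ℕ; _≤_; _^_)
open import Data.Product using (Σ)
open import Data.List using (List; length)
open import Data.List.Relation.Unary.Unique.Propositional using (Unique)

open import Data.Nat using (zero; suc; _+_; _*_; s≤s)
open import Data.Nat.Properties using (*-cancelʳ-≤; *-monoʳ-≤; *-identityʳ; m≤m+n; ≤-trans; module ≤-Reasoning)
open import Data.Nat.Solver using (module +-*-Solver)
open import Data.Bool using (true; false; T; _∨_)
open import Data.Bool.Properties using (T-∧; T-∨)
open import Data.Fin using (Fin; combine; remQuot)
import Data.Fin as F
open import Data.Fin.Properties using (injective⇒≤; remQuot-combine; combine-remQuot)
open import Data.Vec using (Vec; []; _∷_; updateAt; replicate)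
open import Data.Sum using (inj₁; inj₂)
open import Data.Product using (_,_; proj₁; proj₂; uncurry)
import Data.List as List
open import Data.List.Relation.Unary.Any using (index)
open import Data.List.Relation.Unary.Any.Properties using (lookup-index)
open import Data.Unit using (tt)
open import Data.Empty using (⊥-elim)
open import Function.Bundles using (Equivalence)
open import Function.Definitions using (Injective)
open import Relation.Binary.PropositionalEquality using (_≡_; _≢_; refl; sym; trans; cong; cong₂; subst; module ≡-Reasoning)

==L-sound : ∀ x y → T (x ==L y) → x ≡ y
==L-sound a a _ = refl
==L-sound b b _ = refl
==L-sound c c _ = refl
==L-sound a b ()
==L-sound a c ()
==L-sound b a ()
==L-sound b c ()
==L-sound c a ()
==L-sound c b ()

eqVec-sound : ∀ {n} (w z : Vec L n) → T (eqVec w z) → w ≡ z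
eqVec-sound [] [] _ = refl
eqVec-sound (x ∷ xs) (y ∷ ys) t =
  cong₂ _∷_ (==L-sound x y (proj₁ both)) (eqVec-sound xs ys (proj₂ both))
  where both = Equivalence.to T-∧ t

swapAB : L → L
swapAB a = b
swapAB b = a
swapAB c = c

xAdj-swap : ∀ x y → T (xAdj x y) → x ≡ swapAB y
xAdj-swap a b _ = refl
xAdj-swap b a _ = refl
xAdj-swap a a ()
xAdj-swap a c ()
xAdj-swap b b ()
xAdj-swap b c ()
xAdj-swap c a ()
xAdj-swap c b ()
xAdj-swap c c ()

prodAdj-swap : ∀ {n} (w z : Vec L n) → T (prodAdj w z) → Σ (Fin n) λ i → updateAt z i swapAB ≡ w
prodAdj-swap [] [] ()
prodAdj-swap (x ∷ xs) (y ∷ ys) t with Equivalence.to T-∨ t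
... | inj₁ swapHere = F.zero , cong₂ _∷_ (sym (xAdj-swap x y (proj₁ here))) (sym (eqVec-sound xs ys (proj₂ here)))
  where here = Equivalence.to T-∧ swapHere
... | inj₂ swapLater = F.suc (proj₁ rest) , cong₂ _∷_ (sym (==L-sound x y (proj₁ later))) (proj₂ rest)
  where
  later = Equivalence.to T-∧ swapLater
  rest = prodAdj-swap xs ys (proj₂ later)

closedNbr : ∀ {n} → Vec L n → Fin (suc n) → Vec L n
closedNbr z F.zero = z
closedNbr z (F.suc i) = updateAt z i swapAB

closedNbr-complete : ∀ {n} (w z : Vec L n) → T (eqVec w z ∨ prodAdj w z) →
                     Σ (Fin (suc n)) λ i → closedNbr z i ≡ w
closedNbr-complete w z t with Equivalence.to T-∨ t
... | inj₁ equal = F.zero , sym (eqVec-sound w z equal)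
... | inj₂ adjacent with prodAdj-swap w z adjacent
...   | i , swapped = F.suc i , swapped

-- The X̂^k-part of a vertex of X_k (the vertices s_j are sent to an arbitrary point).
base : ∀ {k} → V k → Vec L k
base (inj₁ (_ ∷ z′)) = z′
base {k} (inj₂ _) = replicate k a

-- Any vertex resolving the twins (b,w) and (c,w) lies above the closed neighbourhood of w:
-- the s_j see both twins alike, and a product vertex (z₀,z') with z' ∉ N[w] is at
-- d₁-distance 2 from both.
resolver-near : ∀ {k} (w : Vec L k) (z : V k) →
                d₁ (inj₁ (b ∷ w)) z ≢ d₁ (inj₁ (c ∷ w)) z → T (eqVec w (base z) ∨ prodAdj w (base z))
resolver-near w (inj₂ F.zero) differ = ⊥-elim (differ refl)
resolver-near w (inj₂ (F.suc j)) differ = ⊥-elim (differ refl)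
resolver-near w (inj₁ (z₀ ∷ z′)) differ with eqVec w z′ | prodAdj w z′
... | true | _ = tt
... | false | true = tt
resolver-near w (inj₁ (a ∷ z′)) differ | false | false = ⊥-elim (differ refl)
resolver-near w (inj₁ (b ∷ z′)) differ | false | false = ⊥-elim (differ refl)
resolver-near w (inj₁ (c ∷ z′)) differ | false | false = ⊥-elim (differ refl)

covering-bound : ∀ {X : Set} {n m p} (f : Fin n → X) → Injective _≡_ _≡_ f →
                 (g : Fin m → Fin p → X) → (∀ x → Σ (Fin m) λ i → Σ (Fin p) λ j → g i j ≡ x) →
                 n ≤ m * p
covering-bound {m = m} {p} f f-inj g covers = injective⇒≤ {f = code} code-inj
  where
  code : _ → Fin (m * p)
  code x = combine (proj₁ (covers (f x))) (proj₁ (proj₂ (covers (f x))))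

  decode-code : ∀ x → uncurry g (remQuot p (code x)) ≡ f x
  decode-code x = trans (cong (uncurry g) (remQuot-combine {m} {p} i j)) (proj₂ (proj₂ (covers (f x))))
    where
    i = proj₁ (covers (f x))
    j = proj₁ (proj₂ (covers (f x)))

  code-inj : Injective _≡_ _≡_ code
  code-inj {x} {y} eq = f-inj (begin
    f x                          ≡⟨ sym (decode-code x) ⟩
    uncurry g (remQuot p (code x)) ≡⟨ cong (λ q → uncurry g (remQuot p q)) eq ⟩
    uncurry g (remQuot p (code y)) ≡⟨ decode-code y ⟩
    f y                          ∎)
    where open ≡-Reasoning

toL : Fin 3 → L
toL F.zero = a
toL (F.suc F.zero) = b
toL (F.suc (F.suc F.zero)) = c

fromL : L → Fin 3
fromL a = F.zero
fromL b = F.suc F.zero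
fromL c = F.suc (F.suc F.zero)

fromL-toL : ∀ i → fromL (toL i) ≡ i
fromL-toL F.zero = refl
fromL-toL (F.suc F.zero) = refl
fromL-toL (F.suc (F.suc F.zero)) = refl

toVec : ∀ k → Fin (3 ^ k) → Vec L k
toVec zero _ = []
toVec (suc k) i = toL (proj₁ (remQuot {3} (3 ^ k) i)) ∷ toVec k (proj₂ (remQuot {3} (3 ^ k) i))

fromVec : ∀ {k} → Vec L k → Fin (3 ^ k)
fromVec [] = F.zero
fromVec (x ∷ xs) = combine (fromL x) (fromVec xs)

fromVec-toVec : ∀ k (i : Fin (3 ^ k)) → fromVec (toVec k i) ≡ i
fromVec-toVec zero F.zero = refl
fromVec-toVec (suc k) i =
  trans (cong₂ combine (fromL-toL (proj₁ (remQuot {3} (3 ^ k) i))) (fromVec-toVec k (proj₂ (remQuot {3} (3 ^ k) i))))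
        (combine-remQuot {3} (3 ^ k) i)

toVec-injective : ∀ k → Injective _≡_ _≡_ (toVec k)
toVec-injective k {i} {j} eq = trans (sym (fromVec-toVec k i)) (trans (cong fromVec eq) (fromVec-toVec k j))

-- Every adjacency resolving set A of X_k satisfies 3^k ≤ |A|·(k+1): the pairs
-- (position of a resolving vertex in A, index in its closed neighbourhood) cover {a,b,c}^k.
resolving-bound : ∀ k (A : List (V k)) → AdjResolving k A → 3 ^ k ≤ length A * suc k
resolving-bound k A resolving = covering-bound (toVec k) (toVec-injective k) neighbour covers
  where
  neighbour : Fin (length A) → Fin (suc k) → Vec L k
  neighbour i j = closedNbr (base (List.lookup A i)) j

  covers : ∀ w → Σ (Fin (length A)) λ i → Σ (Fin (suc k)) λ j → neighbour i j ≡ w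
  covers w with resolving (inj₁ (b ∷ w)) (inj₁ (c ∷ w)) (λ ())
  ... | z , z∈A , differ with closedNbr-complete w (base z) (resolver-near w z differ)
  ...   | j , w-near = index z∈A , j , subst (λ z′ → closedNbr (base z′) j ≡ w) (lookup-index z∈A) w-near

exponential-beats-linear : ∀ n → 2 ^ (4 + n) * (5 + n) ≤ 3 ^ (4 + n)
exponential-beats-linear zero = m≤m+n 80 1
exponential-beats-linear (suc n) = begin
  2 * p * (6 + n)                         ≡⟨ solve 2 (λ p n → con 2 :* p :* (con 6 :+ n) := p :* (con 12 :+ con 2 :* n)) refl p n ⟩
  p * (12 + 2 * n)                        ≤⟨ m≤m+n _ _ ⟩
  p * (12 + 2 * n) + p * (3 + n)          ≡⟨ solve 2 (λ p n → p :* (con 12 :+ con 2 :* n) :+ p :* (con 3 :+ n) := con 3 :* (p :* (con 5 :+ n))) refl p n ⟩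
  3 * (p * (5 + n))                       ≤⟨ *-monoʳ-≤ 3 (exponential-beats-linear n) ⟩
  3 * 3 ^ (4 + n)                         ∎
  where
  open ≤-Reasoning
  open +-*-Solver
  p = 2 ^ (4 + n)

lemma5p4 : Σ ℕ λ d → Σ ℕ λ k₀ → (k : ℕ) → k₀ ≤ k → 1 ≤ k →
    (A : List (V k)) → Unique A → AdjResolving k A → 2 ^ k ≤ length A ^ d
lemma5p4 = 1 , 4 , bound
  where
  bound : (k : ℕ) → 4 ≤ k → 1 ≤ k → (A : List (V k)) → Unique A → AdjResolving k A → 2 ^ k ≤ length A ^ 1
  bound k@(suc (suc (suc (suc n)))) (s≤s (s≤s (s≤s (s≤s _)))) _ A _ resolving =
    subst (2 ^ k ≤_) (sym (*-identityʳ (length A)))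
      (*-cancelʳ-≤ (2 ^ k) (length A) (suc k)
        (≤-trans (exponential-beats-linear n) (resolving-bound k A resolving)))
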